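{- Let $G$ be a closed subgroup of $\operatorname{SL}_2(\mathbb{Z}_2)$ whose reduction modulo $4$ is trivial. Let $e_1,e_2\ge 2$ be integers and $x_1,x_2\in\Theta(G)$ with $x_1\equiv 0\pmod{2^{e_1}}$ and $x_2\equiv 0\pmod{2^{e_2}}$. Then $\Theta(G)$ contains an element $y$ with $y\equiv x_1+x_2\pmod{2^{e_1+e_2-1}}$. If moreover $x_1$ and $x_2$ are both upper-triangular, then such a $y$ can be chosen upper-triangular as well.
   Context: $\Theta(g)=g-\frac{\operatorname{tr}(g)}{2}\operatorname{Id}\in\mathfrak{sl}_2(\mathbb{Z}_2)$ for $g\in G$. Congruences between matrices are entrywise. -}

module Defs where

open import Data.Nat using (ℕ; suc; _^_; _∸_)
open import Data.Integer using (ℤ; +_; _+_; _*_; _-_; -_; 0ℤ; 1ℤ)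
open import Data.Integer.Divisibility.Signed using (_∣_; ∣m∣n⇒∣m+n; ∣n⇒∣m*n; ∣m⇒∣m*n; ∣-refl)
open import Data.Integer.Solver using (module +-*-Solver)
open import Data.Product using (Σ; ∃; _×_; _,_)
open import Relation.Binary.PropositionalEquality using (_≡_; subst; sym)

-- 2-adic integers Z₂ = lim Z/2ⁿZ, represented by a sequence of integer
-- approximations (seq n is a representative of x mod 2ⁿ) that is
-- compatible: seq (n+1) ≡ seq n (mod 2ⁿ).

pow2 : ℕ → ℤ
pow2 n = + (2 ^ n)

record ℤ₂ : Set where
  constructor mkℤ₂
  field
    seq    : ℕ → ℤ
    compat : ∀ n → pow2 n ∣ (seq (suc n) - seq n)
open ℤ₂ public

_≡_[mod2^_] : ℤ₂ → ℤ₂ → ℕ → Set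
x ≡ y [mod2^ e ] = pow2 e ∣ (seq x e - seq y e)

infix 4 _≈_
_≈_ : ℤ₂ → ℤ₂ → Set
x ≈ y = ∀ n → x ≡ y [mod2^ n ]

private
  open +-*-Solver

  add-lem : ∀ a a' b b' → (a' + b') - (a + b) ≡ (a' - a) + (b' - b)
  add-lem = solve 4 (λ a a' b b' → (a' :+ b') :- (a :+ b) := (a' :- a) :+ (b' :- b)) Relation.Binary.PropositionalEquality.refl

  mul-lem : ∀ a a' b b' → (a' * b') - (a * b) ≡ a' * (b' - b) + (a' - a) * b
  mul-lem = solve 4 (λ a a' b b' → (a' :* b') :- (a :* b) := a' :* (b' :- b) :+ (a' :- a) :* b) Relation.Binary.PropositionalEquality.refl

  neg-lem : ∀ a a' → (- a') - (- a) ≡ (a' - a) * (- 1ℤ)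
  neg-lem = solve 2 (λ a a' → (:- a') :- (:- a) := (a' :- a) :* (:- con 1ℤ)) Relation.Binary.PropositionalEquality.refl

  const-lem : ∀ a b → a - a ≡ b * 0ℤ
  const-lem = solve 2 (λ a b → a :- a := b :* con 0ℤ) Relation.Binary.PropositionalEquality.refl

constℤ₂ : ℤ → ℤ₂
constℤ₂ z = mkℤ₂ (λ _ → z) (λ n → subst (pow2 n ∣_) (sym (const-lem z (pow2 n))) (∣m⇒∣m*n 0ℤ ∣-refl))

0₂ 1₂ : ℤ₂
0₂ = constℤ₂ 0ℤ
1₂ = constℤ₂ 1ℤ

infixl 6 _+₂_ _-₂_
infixl 7 _*₂_

_+₂_ : ℤ₂ → ℤ₂ → ℤ₂
x +₂ y = mkℤ₂ (λ n → seq x n + seq y n)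
  (λ n → subst (pow2 n ∣_) (sym (add-lem (seq x n) (seq x (suc n)) (seq y n) (seq y (suc n))))
           (∣m∣n⇒∣m+n (compat x n) (compat y n)))

-₂_ : ℤ₂ → ℤ₂
-₂ x = mkℤ₂ (λ n → - seq x n)
  (λ n → subst (pow2 n ∣_) (sym (neg-lem (seq x n) (seq x (suc n)))) (∣m⇒∣m*n (- 1ℤ) (compat x n)))

_-₂_ : ℤ₂ → ℤ₂ → ℤ₂
x -₂ y = x +₂ (-₂ y)

_*₂_ : ℤ₂ → ℤ₂ → ℤ₂
x *₂ y = mkℤ₂ (λ n → seq x n * seq y n)
  (λ n → subst (pow2 n ∣_) (sym (mul-lem (seq x n) (seq x (suc n)) (seq y n) (seq y (suc n))))
           (∣m∣n⇒∣m+n (∣n⇒∣m*n (seq x (suc n)) (compat y n)) (∣m⇒∣m*n (seq y n) (compat x n))))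

record M₂ : Set where
  constructor mat
  field
    m11 m12 m21 m22 : ℤ₂
open M₂ public

Id : M₂
Id = mat 1₂ 0₂ 0₂ 1₂

_+M_ : M₂ → M₂ → M₂
A +M B = mat (m11 A +₂ m11 B) (m12 A +₂ m12 B) (m21 A +₂ m21 B) (m22 A +₂ m22 B)

_-M_ : M₂ → M₂ → M₂
A -M B = mat (m11 A -₂ m11 B) (m12 A -₂ m12 B) (m21 A -₂ m21 B) (m22 A -₂ m22 B)

_*M_ : M₂ → M₂ → M₂
A *M B = mat (m11 A *₂ m11 B +₂ m12 A *₂ m21 B) (m11 A *₂ m12 B +₂ m12 A *₂ m22 B)
             (m21 A *₂ m11 B +₂ m22 A *₂ m21 B) (m21 A *₂ m12 B +₂ m22 A *₂ m22 B)

_·M_ : ℤ₂ → M₂ → M₂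
t ·M A = mat (t *₂ m11 A) (t *₂ m12 A) (t *₂ m21 A) (t *₂ m22 A)

det : M₂ → ℤ₂
det A = m11 A *₂ m22 A -₂ m12 A *₂ m21 A

tr : M₂ → ℤ₂
tr A = m11 A +₂ m22 A

-- inverse of an element of SL₂ (the adjugate)
inv : M₂ → M₂
inv A = mat (m22 A) (-₂ m12 A) (-₂ m21 A) (m11 A)

_≡M_[mod2^_] : M₂ → M₂ → ℕ → Set
A ≡M B [mod2^ e ] = (m11 A ≡ m11 B [mod2^ e ]) × (m12 A ≡ m12 B [mod2^ e ])
                  × (m21 A ≡ m21 B [mod2^ e ]) × (m22 A ≡ m22 B [mod2^ e ])

_≈M_ : M₂ → M₂ → Set
A ≈M B = (m11 A ≈ m11 B) × (m12 A ≈ m12 B) × (m21 A ≈ m21 B) × (m22 A ≈ m22 B)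

UpperTriangular : M₂ → Set
UpperTriangular A = m21 A ≈ 0₂

record ClosedSubgroupSL₂ (G : M₂ → Set) : Set where
  field
    respects : ∀ {A B} → A ≈M B → G A → G B
    inSL₂    : ∀ {A} → G A → det A ≈ 1₂
    id∈      : G Id
    mul∈     : ∀ {A B} → G A → G B → G (A *M B)
    inv∈     : ∀ {A} → G A → G (inv A)
    closed   : ∀ A → (∀ n → Σ M₂ (λ B → G B × (B ≡M A [mod2^ n ]))) → G A

TrivialMod4 : (M₂ → Set) → Set
TrivialMod4 G = ∀ {A} → G A → A ≡M Id [mod2^ 2 ]

-- Θ(g) = g - (tr g / 2)·Id.  Division by 2 in Z₂ is expressed by its
-- defining property: t = tr g / 2 is the (unique) t with t + t = tr g.
-- "IsΘ g y" means y = Θ(g).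

IsΘ : M₂ → M₂ → Set
IsΘ g y = Σ ℤ₂ (λ t → (t +₂ t ≈ tr g) × (y ≈M (g -M (t ·M Id))))

_∈Θ_ : M₂ → (M₂ → Set) → Set
y ∈Θ G = Σ M₂ (λ g → G g × IsΘ g y)

0M : M₂
0M = mat 0₂ 0₂ 0₂ 0₂

module Submission where

-- Write gᵢ = tᵢ·Id + xᵢ, where tᵢ = tr(gᵢ)/2, so that xᵢ = Θ(gᵢ). Modulo 2^eᵢ the matrix gᵢ is
-- the scalar tᵢ, so det gᵢ = 1 gives tᵢ² ≡ 1 (mod 2^eᵢ); as gᵢ ≡ Id (mod 4), tᵢ + 1 is twice an
-- odd number, hence tᵢ ≡ 1 (mod 2^(eᵢ-1)). Expanding,
--   g₁g₂ = t₁t₂·Id + R,   R = t₂x₁ + t₁x₂ + x₁x₂,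
-- where tr R ≡ 0 (mod 2^(e₁+e₂)) because tr xᵢ = 0 and x₁x₂ ≡ 0 (mod 2^(e₁+e₂)). So the half
-- trace T of g₁g₂ is ≡ t₁t₂ (mod 2^(e₁+e₂-1)), and Θ(g₁g₂) = g₁g₂ - T·Id ≡ R ≡ x₁ + x₂ modulo
-- 2^(e₁+e₂-1). Upper-triangularity passes from xᵢ to gᵢ, to g₁g₂, and to Θ(g₁g₂).

open import Defs
open import Data.Nat.Base as ℕ using (ℕ; zero; suc; _≤_; _≤′_; ≤′-refl; ≤′-step; s≤s; z≤n)
open import Data.Nat.Properties as ℕₚ using (≤⇒≤′)
open import Data.Product using (Σ; _×_; _,_; proj₁; proj₂)
open import Relation.Binary.Bundles using (Setoid)
import Relation.Binary.Reasoning.Setoid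
open import Relation.Binary.PropositionalEquality as ≡ using (_≡_; cong; subst; subst₂)

-- The integer operations are opened only inside this module, so that _+_ in the statement of
-- lemma5p4 is still addition of natural numbers.
module _ where
  open import Data.Integer.Base using (ℤ; +_; 0ℤ; 1ℤ; _+_; _-_; _*_; -_)
  open import Data.Integer.Divisibility.Signed
  open import Data.Integer.Properties
    using (pos-*; *-identityˡ; *-identityʳ; *-comm; +-identityʳ; +-inverseʳ)
  open import Data.Integer.Tactic.RingSolver using (solve-∀)

  -- A record rather than a synonym for m ∣ a - b, so that a, b and m can be inferred.
  infix 4 _≡_[mod_]
  record _≡_[mod_] (a b m : ℤ) : Set where
    constructor ∣-diff
    field divides-diff : m ∣ a - b
  open _≡_[mod_]

  private
    variable
      a b c d m n s s′ : ℤ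

    ∣-diff-by : ∀ {x} → m ∣ x → x ≡ a - b → a ≡ b [mod m ]
    ∣-diff-by {m} m∣x x≡a-b = ∣-diff (subst (m ∣_) x≡a-b m∣x)

  ≡⇒≡-mod : a ≡ b → a ≡ b [mod m ]
  ≡⇒≡-mod {a} ≡.refl = ∣-diff-by (divides 0ℤ ≡.refl) (≡.sym (+-inverseʳ a))

  ≡-mod-refl : ∀ a → a ≡ a [mod m ]
  ≡-mod-refl a = ≡⇒≡-mod {a} ≡.refl

  ≡-mod-sym : a ≡ b [mod m ] → b ≡ a [mod m ]
  ≡-mod-sym {a} {b} (∣-diff m∣a-b) = ∣-diff-by (∣m⇒∣-m m∣a-b) (neg-diff a b)
    where
    neg-diff : ∀ a b → - (a - b) ≡ b - a
    neg-diff = solve-∀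

  ≡-mod-trans : a ≡ b [mod m ] → b ≡ c [mod m ] → a ≡ c [mod m ]
  ≡-mod-trans {a} {b} {c = c} (∣-diff m∣a-b) (∣-diff m∣b-c) =
    ∣-diff-by (∣m∣n⇒∣m+n m∣a-b m∣b-c) (telescope a b c)
    where
    telescope : ∀ a b c → (a - b) + (b - c) ≡ a - c
    telescope = solve-∀

  +-cong-mod : a ≡ b [mod m ] → c ≡ d [mod m ] → a + c ≡ b + d [mod m ]
  +-cong-mod {a} {b} {c = c} {d} (∣-diff m∣a-b) (∣-diff m∣c-d) =
    ∣-diff-by (∣m∣n⇒∣m+n m∣a-b m∣c-d) (diff-+ a b c d)
    where
    diff-+ : ∀ a b c d → (a - b) + (c - d) ≡ (a + c) - (b + d)
    diff-+ = solve-∀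

  -‿cong-mod : a ≡ b [mod m ] → - a ≡ - b [mod m ]
  -‿cong-mod {a} {b} (∣-diff m∣a-b) = ∣-diff-by (∣m⇒∣-m m∣a-b) (diff-neg a b)
    where
    diff-neg : ∀ a b → - (a - b) ≡ - a - - b
    diff-neg = solve-∀

  *-cong-mod : a ≡ b [mod m ] → c ≡ d [mod m ] → a * c ≡ b * d [mod m ]
  *-cong-mod {a} {b} {c = c} {d} (∣-diff m∣a-b) (∣-diff m∣c-d) =
    ∣-diff-by (∣m∣n⇒∣m+n (∣m⇒∣m*n c m∣a-b) (∣n⇒∣m*n b m∣c-d)) (diff-* a b c d)
    where
    diff-* : ∀ a b c d → (a - b) * c + b * (c - d) ≡ a * c - b * d
    diff-* = solve-∀

  cast-modulus : m ≡ n → a ≡ b [mod m ] → a ≡ b [mod n ]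
  cast-modulus ≡.refl a≡b = a≡b

  ≡-mod-weaken : d ∣ m → a ≡ b [mod m ] → a ≡ b [mod d ]
  ≡-mod-weaken d∣m (∣-diff m∣a-b) = ∣-diff (∣-trans d∣m m∣a-b)

  *-cong-multiple : a ≡ b [mod m ] → c ≡ 0ℤ [mod n ] → a * c ≡ b * c [mod m * n ]
  *-cong-multiple {a} {b} {m} {c} {n} (∣-diff m∣a-b) (∣-diff n∣c) =
    ∣-diff-by (∣-trans (*-monoʳ-∣ m n∣c) (*-monoˡ-∣ (c - 0ℤ) m∣a-b)) (diff-*ʳ a b c)
    where
    diff-*ʳ : ∀ a b c → (a - b) * (c - 0ℤ) ≡ a * c - b * c
    diff-*ʳ = solve-∀

  halve-mod : a + a ≡ b + b [mod + 2 * m ] → a ≡ b [mod m ]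
  halve-mod {a} {b} {m} (∣-diff 2m∣2a-2b) =
    ∣-diff (*-cancelˡ-∣ (+ 2) (subst (+ 2 * m ∣_) (diff-double a b) 2m∣2a-2b))
    where
    diff-double : ∀ a b → (a + a) - (b + b) ≡ + 2 * (a - b)
    diff-double = solve-∀

  pow2-suc : ∀ k → pow2 (suc k) ≡ + 2 * pow2 k
  pow2-suc k = pos-* 2 (2 ℕ.^ k)

  pow2-+ : ∀ i j → pow2 (i ℕ.+ j) ≡ pow2 i * pow2 j
  pow2-+ i j = ≡.trans (cong +_ (ℕₚ.^-distribˡ-+-* 2 i j)) (pos-* (2 ℕ.^ i) (2 ℕ.^ j))

  pow2-mono-∣ : ∀ {k L} → k ≤′ L → pow2 k ∣ pow2 L
  pow2-mono-∣ ≤′-refl = ∣-refl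
  pow2-mono-∣ {k} (≤′-step {L} k≤′L) =
    subst (pow2 k ∣_) (≡.sym (pow2-suc L)) (∣n⇒∣m*n (+ 2) (pow2-mono-∣ k≤′L))

  pow2∣odd*n⇒pow2∣n : ∀ k q n → pow2 k ∣ (1ℤ + + 2 * q) * n → pow2 k ∣ n
  pow2∣odd*n⇒pow2∣n zero q n _ = divides n (≡.sym (*-identityʳ n))
  pow2∣odd*n⇒pow2∣n (suc k) q n 2^k+1∣odd*n with ∣m+n∣n⇒∣m {m = n} 2∣n+2qn (∣m⇒∣m*n (q * n) ∣-refl)
    where
    odd-split : ∀ q n → (1ℤ + + 2 * q) * n ≡ n + + 2 * (q * n)
    odd-split = solve-∀
    2∣n+2qn : + 2 ∣ n + + 2 * (q * n)
    2∣n+2qn = subst (+ 2 ∣_) (odd-split q n)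
      (∣-trans (subst (+ 2 ∣_) (≡.sym (pow2-suc k)) (∣m⇒∣m*n (pow2 k) ∣-refl)) 2^k+1∣odd*n)
  ... | divides h ≡.refl = subst (_∣ h * + 2) (≡.sym (pow2-suc k))
          (subst (+ 2 * pow2 k ∣_) (*-comm (+ 2) h)
            (*-monoʳ-∣ (+ 2) (pow2∣odd*n⇒pow2∣n k q h 2^k∣odd*h)))
    where
    double-inside : ∀ q h → (1ℤ + + 2 * q) * (h * + 2) ≡ + 2 * ((1ℤ + + 2 * q) * h)
    double-inside = solve-∀
    2^k∣odd*h : pow2 k ∣ (1ℤ + + 2 * q) * h
    2^k∣odd*h = *-cancelˡ-∣ (+ 2) (subst₂ _∣_ (pow2-suc k) (double-inside q h) 2^k+1∣odd*n)

  -- t + 1 = 2(1 + 2q) is twice an odd number, so all but one factor 2 of t² - 1 divide t - 1.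
  t²≡1⇒t≡1 : ∀ k {t} → + 4 ∣ t - 1ℤ → t * t ≡ 1ℤ [mod pow2 (suc k) ] → t ≡ 1ℤ [mod pow2 k ]
  t²≡1⇒t≡1 k {t} (divides q t-1≡q*4) (∣-diff 2^k+1∣t²-1) =
    ∣-diff (pow2∣odd*n⇒pow2∣n k q (t - 1ℤ)
      (*-cancelˡ-∣ (+ 2) (subst₂ _∣_ (pow2-suc k) factor 2^k+1∣t²-1)))
    where
    open ≡.≡-Reasoning
    difference-of-squares : ∀ t → t * t - 1ℤ ≡ (t - 1ℤ) * ((t - 1ℤ) + + 2)
    difference-of-squares = solve-∀
    regroup : ∀ u q → u * (q * + 4 + + 2) ≡ + 2 * ((1ℤ + + 2 * q) * u)
    regroup = solve-∀
    factor : t * t - 1ℤ ≡ + 2 * ((1ℤ + + 2 * q) * (t - 1ℤ))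
    factor = begin
      t * t - 1ℤ                         ≡⟨ difference-of-squares t ⟩
      (t - 1ℤ) * ((t - 1ℤ) + + 2)        ≡⟨ cong (λ u → (t - 1ℤ) * (u + + 2)) t-1≡q*4 ⟩
      (t - 1ℤ) * (q * + 4 + + 2)         ≡⟨ regroup (t - 1ℤ) q ⟩
      + 2 * ((1ℤ + + 2 * q) * (t - 1ℤ))  ∎

  -- The congruence x ≡ y [mod2^ k ] of Defs, stated on the integers seq x k so that unification
  -- never compares elements of ℤ₂ (Agda would normalise their compat proofs, which is very slow).
  infix 4 _≋_[mod2^_]
  _≋_[mod2^_] : ℤ₂ → ℤ₂ → ℕ → Set
  x ≋ y [mod2^ k ] = seq x k ≡ seq y k [mod pow2 k ]

  ≋-setoid : ℕ → Setoid _ _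
  ≋-setoid k = record
    { Carrier       = ℤ₂
    ; _≈_           = _≋_[mod2^ k ]
    ; isEquivalence = record { refl = ≡-mod-refl _ ; sym = ≡-mod-sym ; trans = ≡-mod-trans }
    }

  module ≋-Reasoning (k : ℕ) = Relation.Binary.Reasoning.Setoid (≋-setoid k)

  private
    variable
      i j k L : ℕ

  seq-stable : ∀ x → k ≤′ L → seq x L ≡ seq x k [mod pow2 k ]
  seq-stable x ≤′-refl = ≡-mod-refl _
  seq-stable x (≤′-step {L} k≤′L) =
    ≡-mod-trans (≡-mod-weaken (pow2-mono-∣ k≤′L) (∣-diff (compat x L))) (seq-stable x k≤′L)

  ≋-lift : ∀ x y → k ≤ L → x ≋ y [mod2^ k ] → seq x L ≡ seq y L [mod pow2 k ]
  ≋-lift x y k≤L x≡y = ≡-mod-trans (seq-stable x (≤⇒≤′ k≤L))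
    (≡-mod-trans x≡y (≡-mod-sym (seq-stable y (≤⇒≤′ k≤L))))

  ≋-lower : ∀ x y → k ≤ L → seq x L ≡ seq y L [mod pow2 k ] → x ≋ y [mod2^ k ]
  ≋-lower x y k≤L x≡y = ≡-mod-trans (≡-mod-sym (seq-stable x (≤⇒≤′ k≤L)))
    (≡-mod-trans x≡y (seq-stable y (≤⇒≤′ k≤L)))

  ≋-weaken : ∀ x y → j ≤ k → x ≋ y [mod2^ k ] → x ≋ y [mod2^ j ]
  ≋-weaken x y j≤k x≡y = ≋-lower x y j≤k (≡-mod-weaken (pow2-mono-∣ (≤⇒≤′ j≤k)) x≡y)

  *₂-cong-multiple : ∀ x x′ y → x ≋ x′ [mod2^ i ] → y ≋ 0₂ [mod2^ j ] →
                     x *₂ y ≋ x′ *₂ y [mod2^ (i ℕ.+ j) ]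
  *₂-cong-multiple {i} {j} x x′ y x≡x′ y≡0 = cast-modulus (≡.sym (pow2-+ i j))
    (*-cong-multiple (≋-lift x x′ (ℕₚ.m≤m+n i j) x≡x′) (≋-lift y 0₂ (ℕₚ.m≤n+m j i) y≡0))

  ≋-halve : ∀ x y → x +₂ x ≋ y +₂ y [mod2^ suc k ] → x ≋ y [mod2^ k ]
  ≋-halve {k} x y 2x≡2y = ≋-lower x y (ℕₚ.n≤1+n k) (halve-mod (cast-modulus (pow2-suc k) 2x≡2y))

  t²≋1⇒t≋1 : ∀ t → t ≋ 1₂ [mod2^ 2 ] → t *₂ t ≋ 1₂ [mod2^ suc k ] → t ≋ 1₂ [mod2^ k ]
  t²≋1⇒t≋1 {k} t t≡1 t²≡1 = ≋-lower t 1₂ (ℕₚ.m≤n+m k 2)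
    (t²≡1⇒t≡1 k (divides-diff (≋-lift t 1₂ (ℕₚ.m≤m+n 2 k) t≡1))
                (≋-lift (t *₂ t) 1₂ (ℕₚ.n≤1+n (suc k)) t²≡1))

  even⇒half : ∀ z → z ≋ 0₂ [mod2^ 1 ] → Σ ℤ₂ (λ t → t +₂ t ≈ z)
  even⇒half z z≡0 = half , half+half≈z
    where
    even : ∀ n → + 2 ∣ seq z (suc n)
    even n = subst (+ 2 ∣_) (+-identityʳ (seq z (suc n))) (divides-diff (≋-lift z 0₂ (s≤s z≤n) z≡0))
    -- The level-n approximation of z / 2 is half the level-(n + 1) approximation of z.
    h : ℕ → ℤ
    h n = _∣_.quotient (even n)
    doubling : ∀ a → a * + 2 ≡ a + a
    doubling = solve-∀
    z≡h+h : ∀ n → seq z (suc n) ≡ h n + h n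
    z≡h+h n = ≡.trans (_∣_.equality (even n)) (doubling (h n))
    h-compat : ∀ n → h (suc n) ≡ h n [mod pow2 n ]
    h-compat n = halve-mod (cast-modulus (pow2-suc n)
      (subst₂ (_≡_[mod pow2 (suc n) ]) (z≡h+h (suc n)) (z≡h+h n) (∣-diff (compat z (suc n)))))
    half : ℤ₂
    half = mkℤ₂ h (λ n → divides-diff (h-compat n))
    half+half≈z : half +₂ half ≈ z
    half+half≈z n = subst (λ a → pow2 n ∣ a - seq z n) (z≡h+h n) (compat z n)

  record ℤ²ˣ² : Set where
    constructor ℤmat
    field e₁₁ e₁₂ e₂₁ e₂₂ : ℤ
  open ℤ²ˣ²

  infixl 6 _+ᴹ_ _-ᴹ_
  infixl 7 _*ᴹ_ _·ᴹ_

  _+ᴹ_ _-ᴹ_ _*ᴹ_ : ℤ²ˣ² → ℤ²ˣ² → ℤ²ˣ²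
  P +ᴹ Q = ℤmat (e₁₁ P + e₁₁ Q) (e₁₂ P + e₁₂ Q) (e₂₁ P + e₂₁ Q) (e₂₂ P + e₂₂ Q)
  P -ᴹ Q = ℤmat (e₁₁ P - e₁₁ Q) (e₁₂ P - e₁₂ Q) (e₂₁ P - e₂₁ Q) (e₂₂ P - e₂₂ Q)
  P *ᴹ Q = ℤmat (e₁₁ P * e₁₁ Q + e₁₂ P * e₂₁ Q) (e₁₁ P * e₁₂ Q + e₁₂ P * e₂₂ Q)
                (e₂₁ P * e₁₁ Q + e₂₂ P * e₂₁ Q) (e₂₁ P * e₁₂ Q + e₂₂ P * e₂₂ Q)

  _·ᴹ_ : ℤ → ℤ²ˣ² → ℤ²ˣ²
  s ·ᴹ P = ℤmat (s * e₁₁ P) (s * e₁₂ P) (s * e₂₁ P) (s * e₂₂ P)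

  Iᴹ 0ᴹ : ℤ²ˣ²
  Iᴹ = ℤmat 1ℤ 0ℤ 0ℤ 1ℤ
  0ᴹ = ℤmat 0ℤ 0ℤ 0ℤ 0ℤ

  trᴹ detᴹ : ℤ²ˣ² → ℤ
  trᴹ P = e₁₁ P + e₂₂ P
  detᴹ P = e₁₁ P * e₂₂ P - e₁₂ P * e₂₁ P

  ℤmat-cong : ∀ {a b c d a′ b′ c′ d′} → a ≡ a′ → b ≡ b′ → c ≡ c′ → d ≡ d′ →
              ℤmat a b c d ≡ ℤmat a′ b′ c′ d′
  ℤmat-cong ≡.refl ≡.refl ≡.refl ≡.refl = ≡.refl

  infix 4 _≡ᴹ_[mod_]
  record _≡ᴹ_[mod_] (P Q : ℤ²ˣ²) (m : ℤ) : Set where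
    constructor entrywise
    field
      ≡₁₁ : e₁₁ P ≡ e₁₁ Q [mod m ]
      ≡₁₂ : e₁₂ P ≡ e₁₂ Q [mod m ]
      ≡₂₁ : e₂₁ P ≡ e₂₁ Q [mod m ]
      ≡₂₂ : e₂₂ P ≡ e₂₂ Q [mod m ]
  open _≡ᴹ_[mod_]

  private
    variable
      P P′ Q Q′ S : ℤ²ˣ²

  ≡⇒≡ᴹ : P ≡ Q → P ≡ᴹ Q [mod m ]
  ≡⇒≡ᴹ {P} ≡.refl =
    entrywise (≡-mod-refl (e₁₁ P)) (≡-mod-refl (e₁₂ P)) (≡-mod-refl (e₂₁ P)) (≡-mod-refl (e₂₂ P))

  ≡ᴹ-refl : ∀ P → P ≡ᴹ P [mod m ]
  ≡ᴹ-refl P = ≡⇒≡ᴹ {P} ≡.refl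

  ≡ᴹ-sym : P ≡ᴹ Q [mod m ] → Q ≡ᴹ P [mod m ]
  ≡ᴹ-sym (entrywise p q r s) = entrywise (≡-mod-sym p) (≡-mod-sym q) (≡-mod-sym r) (≡-mod-sym s)

  ≡ᴹ-trans : P ≡ᴹ Q [mod m ] → Q ≡ᴹ S [mod m ] → P ≡ᴹ S [mod m ]
  ≡ᴹ-trans (entrywise p q r s) (entrywise p′ q′ r′ s′) =
    entrywise (≡-mod-trans p p′) (≡-mod-trans q q′) (≡-mod-trans r r′) (≡-mod-trans s s′)

  +ᴹ-cong : P ≡ᴹ P′ [mod m ] → Q ≡ᴹ Q′ [mod m ] → P +ᴹ Q ≡ᴹ P′ +ᴹ Q′ [mod m ]
  +ᴹ-cong (entrywise p q r s) (entrywise p′ q′ r′ s′) =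
    entrywise (+-cong-mod p p′) (+-cong-mod q q′) (+-cong-mod r r′) (+-cong-mod s s′)

  -ᴹ-cong : P ≡ᴹ P′ [mod m ] → Q ≡ᴹ Q′ [mod m ] → P -ᴹ Q ≡ᴹ P′ -ᴹ Q′ [mod m ]
  -ᴹ-cong (entrywise p q r s) (entrywise p′ q′ r′ s′) = entrywise
    (+-cong-mod p (-‿cong-mod p′)) (+-cong-mod q (-‿cong-mod q′))
    (+-cong-mod r (-‿cong-mod r′)) (+-cong-mod s (-‿cong-mod s′))

  *ᴹ-cong : P ≡ᴹ P′ [mod m ] → Q ≡ᴹ Q′ [mod m ] → P *ᴹ Q ≡ᴹ P′ *ᴹ Q′ [mod m ]
  *ᴹ-cong (entrywise p q r s) (entrywise p′ q′ r′ s′) = entrywise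
    (+-cong-mod (*-cong-mod p p′) (*-cong-mod q r′))
    (+-cong-mod (*-cong-mod p q′) (*-cong-mod q s′))
    (+-cong-mod (*-cong-mod r p′) (*-cong-mod s r′))
    (+-cong-mod (*-cong-mod r q′) (*-cong-mod s s′))

  ·ᴹ-cong : s ≡ s′ [mod m ] → P ≡ᴹ P′ [mod m ] → s ·ᴹ P ≡ᴹ s′ ·ᴹ P′ [mod m ]
  ·ᴹ-cong s≡s′ (entrywise p q r s) =
    entrywise (*-cong-mod s≡s′ p) (*-cong-mod s≡s′ q) (*-cong-mod s≡s′ r) (*-cong-mod s≡s′ s)

  trᴹ-cong : P ≡ᴹ Q [mod m ] → trᴹ P ≡ trᴹ Q [mod m ]
  trᴹ-cong (entrywise p _ _ s) = +-cong-mod p s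

  detᴹ-cong : P ≡ᴹ Q [mod m ] → detᴹ P ≡ detᴹ Q [mod m ]
  detᴹ-cong (entrywise p q r s) = +-cong-mod (*-cong-mod p s) (-‿cong-mod (*-cong-mod q r))

  +ᴹ-identityʳ : ∀ P → P +ᴹ 0ᴹ ≡ P
  +ᴹ-identityʳ P = ℤmat-cong (+-identityʳ (e₁₁ P)) (+-identityʳ (e₁₂ P))
                             (+-identityʳ (e₂₁ P)) (+-identityʳ (e₂₂ P))

  +ᴹ-sub : ∀ Q S → Q ≡ S +ᴹ (Q -ᴹ S)
  +ᴹ-sub Q S = ℤmat-cong (add-sub (e₁₁ Q) (e₁₁ S)) (add-sub (e₁₂ Q) (e₁₂ S))
                         (add-sub (e₂₁ Q) (e₂₁ S)) (add-sub (e₂₂ Q) (e₂₂ S))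
    where
    add-sub : ∀ a b → a ≡ b + (a - b)
    add-sub = solve-∀

  scalar+-sub-scalar : ∀ s Q → (s ·ᴹ Iᴹ +ᴹ Q) -ᴹ s ·ᴹ Iᴹ ≡ Q
  scalar+-sub-scalar s Q = ℤmat-cong (cancel s (e₁₁ Q) 1ℤ) (cancel s (e₁₂ Q) 0ℤ)
                                     (cancel s (e₂₁ Q) 0ℤ) (cancel s (e₂₂ Q) 1ℤ)
    where
    cancel : ∀ s a δ → (s * δ + a) - s * δ ≡ a
    cancel = solve-∀

  detᴹ-scalar : ∀ s → detᴹ (s ·ᴹ Iᴹ) ≡ s * s
  detᴹ-scalar s = square s
    where
    square : ∀ s → s * 1ℤ * (s * 1ℤ) - s * 0ℤ * (s * 0ℤ) ≡ s * s
    square = solve-∀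

  trᴹ-sub-scalar : ∀ Q s → trᴹ (Q -ᴹ s ·ᴹ Iᴹ) ≡ trᴹ Q - (s + s)
  trᴹ-sub-scalar Q s = regroup (e₁₁ Q) (e₂₂ Q) s
    where
    regroup : ∀ a d s → (a - s * 1ℤ) + (d - s * 1ℤ) ≡ (a + d) - (s + s)
    regroup = solve-∀

  trᴹ-scalar+ : ∀ s Q → trᴹ (s ·ᴹ Iᴹ +ᴹ Q) ≡ (s + s) + trᴹ Q
  trᴹ-scalar+ s Q = regroup s (e₁₁ Q) (e₂₂ Q)
    where
    regroup : ∀ s a d → (s * 1ℤ + a) + (s * 1ℤ + d) ≡ (s + s) + (a + d)
    regroup = solve-∀

  expandᴹ : ∀ s₁ X₁ s₂ X₂ → (s₁ ·ᴹ Iᴹ +ᴹ X₁) *ᴹ (s₂ ·ᴹ Iᴹ +ᴹ X₂)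
                            ≡ (s₁ * s₂) ·ᴹ Iᴹ +ᴹ ((s₂ ·ᴹ X₁ +ᴹ s₁ ·ᴹ X₂) +ᴹ X₁ *ᴹ X₂)
  expandᴹ s₁ (ℤmat a₁ b₁ c₁ d₁) s₂ (ℤmat a₂ b₂ c₂ d₂) = ℤmat-cong
    (expand₁₁ s₁ s₂ a₁ b₁ a₂ c₂) (expand₁₂ s₁ s₂ a₁ b₁ b₂ d₂)
    (expand₂₁ s₁ s₂ c₁ d₁ a₂ c₂) (expand₂₂ s₁ s₂ c₁ d₁ b₂ d₂)
    where
    expand₁₁ : ∀ s₁ s₂ a₁ b₁ a₂ c₂ →
      (s₁ * 1ℤ + a₁) * (s₂ * 1ℤ + a₂) + (s₁ * 0ℤ + b₁) * (s₂ * 0ℤ + c₂)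
        ≡ s₁ * s₂ * 1ℤ + ((s₂ * a₁ + s₁ * a₂) + (a₁ * a₂ + b₁ * c₂))
    expand₁₁ = solve-∀
    expand₁₂ : ∀ s₁ s₂ a₁ b₁ b₂ d₂ →
      (s₁ * 1ℤ + a₁) * (s₂ * 0ℤ + b₂) + (s₁ * 0ℤ + b₁) * (s₂ * 1ℤ + d₂)
        ≡ s₁ * s₂ * 0ℤ + ((s₂ * b₁ + s₁ * b₂) + (a₁ * b₂ + b₁ * d₂))
    expand₁₂ = solve-∀
    expand₂₁ : ∀ s₁ s₂ c₁ d₁ a₂ c₂ →
      (s₁ * 0ℤ + c₁) * (s₂ * 1ℤ + a₂) + (s₁ * 1ℤ + d₁) * (s₂ * 0ℤ + c₂)
        ≡ s₁ * s₂ * 0ℤ + ((s₂ * c₁ + s₁ * c₂) + (c₁ * a₂ + d₁ * c₂))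
    expand₂₁ = solve-∀
    expand₂₂ : ∀ s₁ s₂ c₁ d₁ b₂ d₂ →
      (s₁ * 0ℤ + c₁) * (s₂ * 0ℤ + b₂) + (s₁ * 1ℤ + d₁) * (s₂ * 1ℤ + d₂)
        ≡ s₁ * s₂ * 1ℤ + ((s₂ * d₁ + s₁ * d₂) + (c₁ * b₂ + d₁ * d₂))
    expand₂₂ = solve-∀

  trᴹ-cross : ∀ s₁ X₁ s₂ X₂ → trᴹ ((s₂ ·ᴹ X₁ +ᴹ s₁ ·ᴹ X₂) +ᴹ X₁ *ᴹ X₂)
                               ≡ (s₂ * trᴹ X₁ + s₁ * trᴹ X₂) + trᴹ (X₁ *ᴹ X₂)
  trᴹ-cross s₁ X₁ s₂ X₂ =
    regroup s₁ s₂ (e₁₁ X₁) (e₂₂ X₁) (e₁₁ X₂) (e₂₂ X₂) (e₁₁ (X₁ *ᴹ X₂)) (e₂₂ (X₁ *ᴹ X₂))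
    where
    regroup : ∀ s₁ s₂ a₁ d₁ a₂ d₂ p q →
      ((s₂ * a₁ + s₁ * a₂) + p) + ((s₂ * d₁ + s₁ * d₂) + q)
        ≡ (s₂ * (a₁ + d₁) + s₁ * (a₂ + d₂)) + (p + q)
    regroup = solve-∀

  -- Every operation on M₂ becomes the corresponding operation on ℤ²ˣ² under at k, by computation.
  at : ℕ → M₂ → ℤ²ˣ²
  at k A = ℤmat (seq (m11 A) k) (seq (m12 A) k) (seq (m21 A) k) (seq (m22 A) k)

  infix 4 _≋M_[mod2^_]
  _≋M_[mod2^_] : M₂ → M₂ → ℕ → Set
  A ≋M B [mod2^ k ] = at k A ≡ᴹ at k B [mod pow2 k ]

  ≋M-setoid : ℕ → Setoid _ _
  ≋M-setoid k = record
    { Carrier       = M₂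
    ; _≈_           = _≋M_[mod2^ k ]
    ; isEquivalence = record { refl = ≡ᴹ-refl _ ; sym = ≡ᴹ-sym ; trans = ≡ᴹ-trans }
    }

  module ≋M-Reasoning (k : ℕ) = Relation.Binary.Reasoning.Setoid (≋M-setoid k)

  ≡M⇒≋M : ∀ A B → A ≡M B [mod2^ k ] → A ≋M B [mod2^ k ]
  ≡M⇒≋M A B (p , q , r , s) = entrywise (∣-diff p) (∣-diff q) (∣-diff r) (∣-diff s)

  ≋M⇒≡M : ∀ A B → A ≋M B [mod2^ k ] → A ≡M B [mod2^ k ]
  ≋M⇒≡M A B (entrywise p q r s) = divides-diff p , divides-diff q , divides-diff r , divides-diff s

  ≈M⇒≋M : ∀ A B → A ≈M B → A ≋M B [mod2^ k ]
  ≈M⇒≋M {k} A B (p , q , r , s) =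
    entrywise (∣-diff (p k)) (∣-diff (q k)) (∣-diff (r k)) (∣-diff (s k))

  ≈M-refl : ∀ A → A ≈M A
  ≈M-refl A = ≈-refl (m11 A) , ≈-refl (m12 A) , ≈-refl (m21 A) , ≈-refl (m22 A)
    where
    ≈-refl : ∀ x → x ≈ x
    ≈-refl x n = divides-diff (≡-mod-refl (seq x n))

  ≋M-weaken : ∀ A B → j ≤ k → A ≋M B [mod2^ k ] → A ≋M B [mod2^ j ]
  ≋M-weaken A B j≤k (entrywise p q r s) = entrywise
    (≋-weaken (m11 A) (m11 B) j≤k p) (≋-weaken (m12 A) (m12 B) j≤k q)
    (≋-weaken (m21 A) (m21 B) j≤k r) (≋-weaken (m22 A) (m22 B) j≤k s)

  ·M-near-one : ∀ t A → t ≋ 1₂ [mod2^ i ] → A ≋M 0M [mod2^ j ] → t ·M A ≋M A [mod2^ (i ℕ.+ j) ]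
  ·M-near-one {i} {j} t A t≡1 (entrywise p q r s) =
    entrywise (near-one (m11 A) p) (near-one (m12 A) q) (near-one (m21 A) r) (near-one (m22 A) s)
    where
    near-one : ∀ x → x ≋ 0₂ [mod2^ j ] → t *₂ x ≋ x [mod2^ (i ℕ.+ j) ]
    near-one x x≡0 =
      ≡-mod-trans (*₂-cong-multiple t 1₂ x t≡1 x≡0) (≡⇒≡-mod (*-identityˡ (seq x (i ℕ.+ j))))

  *M-multiple : ∀ A B → A ≋M 0M [mod2^ i ] → B ≋M 0M [mod2^ j ] → A *M B ≋M 0M [mod2^ (i ℕ.+ j) ]
  *M-multiple A B (entrywise p q r s) (entrywise p′ q′ r′ s′) = entrywise
    (+-cong-mod (product (m11 A) (m11 B) p p′) (product (m12 A) (m21 B) q r′))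
    (+-cong-mod (product (m11 A) (m12 B) p q′) (product (m12 A) (m22 B) q s′))
    (+-cong-mod (product (m21 A) (m11 B) r p′) (product (m22 A) (m21 B) s r′))
    (+-cong-mod (product (m21 A) (m12 B) r q′) (product (m22 A) (m22 B) s s′))
    where
    product : ∀ x y → x ≋ 0₂ [mod2^ i ] → y ≋ 0₂ [mod2^ j ] → x *₂ y ≋ 0₂ [mod2^ (i ℕ.+ j) ]
    product x y = *₂-cong-multiple x 0₂ y

  tr-even : ∀ g → g ≡M Id [mod2^ 2 ] → tr g ≋ 0₂ [mod2^ 1 ]
  tr-even g g≡Id = ≡-mod-trans (trᴹ-cong (≋M-weaken g Id (s≤s z≤n) (≡M⇒≋M g Id g≡Id))) trId≡0
    where
    trId≡0 : tr Id ≋ 0₂ [mod2^ 1 ]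
    trId≡0 = ∣-diff ∣-refl

  Θ-decomposition : ∀ g t x → x ≈M (g -M (t ·M Id)) → g ≋M (t ·M Id) +M x [mod2^ k ]
  Θ-decomposition {k} g t x x≈g-tId = ≡ᴹ-trans (≡⇒≡ᴹ (+ᴹ-sub (at k g) (at k (t ·M Id))))
    (+ᴹ-cong (≡ᴹ-refl (at k (t ·M Id))) (≡ᴹ-sym (≈M⇒≋M x (g -M (t ·M Id)) x≈g-tId)))

  tr-Θ≋0 : ∀ g t x → t +₂ t ≈ tr g → x ≈M (g -M (t ·M Id)) → tr x ≋ 0₂ [mod2^ k ]
  tr-Θ≋0 {k} g t x 2t≈trg x≈g-tId = begin
    tr x                  ≈⟨ trᴹ-cong (≈M⇒≋M x (g -M (t ·M Id)) x≈g-tId) ⟩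
    tr (g -M (t ·M Id))   ≈⟨ ≡⇒≡-mod (trᴹ-sub-scalar (at k g) (seq t k)) ⟩
    tr g -₂ (t +₂ t)      ≈⟨ +-cong-mod trg≡2t (≡-mod-refl (- seq (t +₂ t) k)) ⟩
    (t +₂ t) -₂ (t +₂ t)  ≈⟨ ≡⇒≡-mod (+-inverseʳ (seq (t +₂ t) k)) ⟩
    0₂                    ∎
    where
    open ≋-Reasoning k
    trg≡2t : tr g ≋ t +₂ t [mod2^ k ]
    trg≡2t = ≡-mod-sym (∣-diff (2t≈trg k))

  half-trace≋1 : ∀ {f} g t x → det g ≈ 1₂ → g ≡M Id [mod2^ 2 ] →
    x ≈M (g -M (t ·M Id)) → x ≋M 0M [mod2^ suc (suc f) ] → t ≋ 1₂ [mod2^ suc f ]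
  half-trace≋1 {f} g t x det≈1 g≡Id x≈g-tId x≡0 = t²≋1⇒t≋1 t t≡1 t²≡1
    where
    e : ℕ
    e = suc (suc f)
    g≡tId : g ≋M t ·M Id [mod2^ e ]
    g≡tId = begin
      g                  ≈⟨ Θ-decomposition g t x x≈g-tId ⟩
      (t ·M Id) +M x     ≈⟨ +ᴹ-cong (≡ᴹ-refl (at e (t ·M Id))) x≡0 ⟩
      (t ·M Id) +M 0M    ≈⟨ ≡⇒≡ᴹ (+ᴹ-identityʳ (at e (t ·M Id))) ⟩
      t ·M Id            ∎
      where open ≋M-Reasoning e
    t²≡1 : t *₂ t ≋ 1₂ [mod2^ e ]
    t²≡1 = begin
      t *₂ t         ≈⟨ ≡⇒≡-mod (detᴹ-scalar (seq t e)) ⟨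
      det (t ·M Id)  ≈⟨ detᴹ-cong g≡tId ⟨
      det g          ≈⟨ ∣-diff (det≈1 e) ⟩
      1₂             ∎
      where open ≋-Reasoning e
    t≡1 : t ≋ 1₂ [mod2^ 2 ]
    t≡1 = begin
      t        ≈⟨ ≡⇒≡-mod (*-identityʳ (seq t 2)) ⟨
      t *₂ 1₂  ≈⟨ ≡₁₁ (≋M-weaken g (t ·M Id) (s≤s (s≤s z≤n)) g≡tId) ⟨
      m11 g    ≈⟨ ∣-diff (proj₁ g≡Id) ⟩
      1₂       ∎
      where open ≋-Reasoning 2

  cross : ℤ₂ → M₂ → ℤ₂ → M₂ → M₂
  cross s₁ x₁ s₂ x₂ = ((s₂ ·M x₁) +M (s₁ ·M x₂)) +M (x₁ *M x₂)

  product-decomposition : ∀ g₁ g₂ t₁ t₂ x₁ x₂ →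
    x₁ ≈M (g₁ -M (t₁ ·M Id)) → x₂ ≈M (g₂ -M (t₂ ·M Id)) →
    g₁ *M g₂ ≋M ((t₁ *₂ t₂) ·M Id) +M cross t₁ x₁ t₂ x₂ [mod2^ k ]
  product-decomposition {k} g₁ g₂ t₁ t₂ x₁ x₂ x₁≈ x₂≈ = begin
    g₁ *M g₂
      ≈⟨ *ᴹ-cong (Θ-decomposition g₁ t₁ x₁ x₁≈) (Θ-decomposition g₂ t₂ x₂ x₂≈) ⟩
    ((t₁ ·M Id) +M x₁) *M ((t₂ ·M Id) +M x₂)
      ≈⟨ ≡⇒≡ᴹ (expandᴹ (seq t₁ k) (at k x₁) (seq t₂ k) (at k x₂)) ⟩
    ((t₁ *₂ t₂) ·M Id) +M cross t₁ x₁ t₂ x₂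
      ∎
    where open ≋M-Reasoning k

  tr-cross≋0 : ∀ t₁ x₁ t₂ x₂ → tr x₁ ≋ 0₂ [mod2^ k ] → tr x₂ ≋ 0₂ [mod2^ k ] →
    x₁ *M x₂ ≋M 0M [mod2^ k ] → tr (cross t₁ x₁ t₂ x₂) ≋ 0₂ [mod2^ k ]
  tr-cross≋0 {k} t₁ x₁ t₂ x₂ trx₁≡0 trx₂≡0 x₁x₂≡0 = begin
    tr (cross t₁ x₁ t₂ x₂)
      ≈⟨ ≡⇒≡-mod (trᴹ-cross (seq t₁ k) (at k x₁) (seq t₂ k) (at k x₂)) ⟩
    (t₂ *₂ tr x₁ +₂ t₁ *₂ tr x₂) +₂ tr (x₁ *M x₂)
      ≈⟨ +-cong-mod (+-cong-mod (*-cong-mod (≡-mod-refl (seq t₂ k)) trx₁≡0)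
                                (*-cong-mod (≡-mod-refl (seq t₁ k)) trx₂≡0))
                    (trᴹ-cong x₁x₂≡0) ⟩
    (t₂ *₂ 0₂ +₂ t₁ *₂ 0₂) +₂ tr 0M
      ≈⟨ ≡⇒≡-mod (vanish (seq t₂ k) (seq t₁ k)) ⟩
    0₂
      ∎
    where
    open ≋-Reasoning k
    vanish : ∀ a b → (a * 0ℤ + b * 0ℤ) + (0ℤ + 0ℤ) ≡ 0ℤ
    vanish = solve-∀

  half-trace≋scalar : ∀ g s R T → g ≋M (s ·M Id) +M R [mod2^ suc k ] →
    tr R ≋ 0₂ [mod2^ suc k ] → T +₂ T ≈ tr g → T ≋ s [mod2^ k ]
  half-trace≋scalar {k} g s R T g≡s+R trR≡0 2T≈trg = ≋-halve T s (begin
    T +₂ T                ≈⟨ ∣-diff (2T≈trg (suc k)) ⟩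
    tr g                  ≈⟨ trᴹ-cong g≡s+R ⟩
    tr ((s ·M Id) +M R)   ≈⟨ ≡⇒≡-mod (trᴹ-scalar+ (seq s (suc k)) (at (suc k) R)) ⟩
    (s +₂ s) +₂ tr R      ≈⟨ +-cong-mod (≡-mod-refl (seq (s +₂ s) (suc k))) trR≡0 ⟩
    (s +₂ s) +₂ 0₂        ≈⟨ ≡⇒≡-mod (+-identityʳ (seq (s +₂ s) (suc k))) ⟩
    s +₂ s                ∎)
    where open ≋-Reasoning (suc k)

  cross≋sum : ∀ {d₁ d₂} t₁ x₁ t₂ x₂ → t₁ ≋ 1₂ [mod2^ d₁ ] → t₂ ≋ 1₂ [mod2^ d₂ ] →
    x₁ ≋M 0M [mod2^ suc d₁ ] → x₂ ≋M 0M [mod2^ suc d₂ ] →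
    cross t₁ x₁ t₂ x₂ ≋M x₁ +M x₂ [mod2^ (d₁ ℕ.+ suc d₂) ]
  cross≋sum {d₁} {d₂} t₁ x₁ t₂ x₂ t₁≡1 t₂≡1 x₁≡0 x₂≡0 = begin
    cross t₁ x₁ t₂ x₂   ≈⟨ +ᴹ-cong (+ᴹ-cong t₂x₁≡x₁ (·M-near-one t₁ x₂ t₁≡1 x₂≡0)) x₁x₂≡0 ⟩
    (x₁ +M x₂) +M 0M    ≈⟨ ≡⇒≡ᴹ (+ᴹ-identityʳ (at N (x₁ +M x₂))) ⟩
    x₁ +M x₂            ∎
    where
    N : ℕ
    N = d₁ ℕ.+ suc d₂
    open ≋M-Reasoning N
    N≡d₂+suc-d₁ : N ≡ d₂ ℕ.+ suc d₁
    N≡d₂+suc-d₁ = ≡.trans (ℕₚ.+-comm d₁ (suc d₂)) (≡.sym (ℕₚ.+-suc d₂ d₁))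
    t₂x₁≡x₁ : t₂ ·M x₁ ≋M x₁ [mod2^ N ]
    t₂x₁≡x₁ = ≋M-weaken (t₂ ·M x₁) x₁ (ℕₚ.≤-reflexive N≡d₂+suc-d₁) (·M-near-one t₂ x₁ t₂≡1 x₁≡0)
    x₁x₂≡0 : x₁ *M x₂ ≋M 0M [mod2^ N ]
    x₁x₂≡0 = ≋M-weaken (x₁ *M x₂) 0M (ℕₚ.n≤1+n N) (*M-multiple x₁ x₂ x₁≡0 x₂≡0)

  Θ-product : ∀ {d₁ d₂} g₁ g₂ x₁ x₂ t₁ t₂ T →
    x₁ ≈M (g₁ -M (t₁ ·M Id)) → x₂ ≈M (g₂ -M (t₂ ·M Id)) →
    t₁ +₂ t₁ ≈ tr g₁ → t₂ +₂ t₂ ≈ tr g₂ → T +₂ T ≈ tr (g₁ *M g₂) →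
    t₁ ≋ 1₂ [mod2^ d₁ ] → t₂ ≋ 1₂ [mod2^ d₂ ] →
    x₁ ≋M 0M [mod2^ suc d₁ ] → x₂ ≋M 0M [mod2^ suc d₂ ] →
    (g₁ *M g₂) -M (T ·M Id) ≋M x₁ +M x₂ [mod2^ (d₁ ℕ.+ suc d₂) ]
  Θ-product {d₁} {d₂} g₁ g₂ x₁ x₂ t₁ t₂ T
    x₁≈ x₂≈ 2t₁≈trg₁ 2t₂≈trg₂ 2T≈trg t₁≡1 t₂≡1 x₁≡0 x₂≡0 = begin
    (g₁ *M g₂) -M (T ·M Id)
      ≈⟨ -ᴹ-cong (product-decomposition g₁ g₂ t₁ t₂ x₁ x₂ x₁≈ x₂≈) (·ᴹ-cong T≡t₁t₂ (≡ᴹ-refl Iᴹ)) ⟩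
    (((t₁ *₂ t₂) ·M Id) +M R) -M ((t₁ *₂ t₂) ·M Id)
      ≈⟨ ≡⇒≡ᴹ (scalar+-sub-scalar (seq (t₁ *₂ t₂) N) (at N R)) ⟩
    R
      ≈⟨ cross≋sum t₁ x₁ t₂ x₂ t₁≡1 t₂≡1 x₁≡0 x₂≡0 ⟩
    x₁ +M x₂
      ∎
    where
    N : ℕ
    N = d₁ ℕ.+ suc d₂
    R : M₂
    R = cross t₁ x₁ t₂ x₂
    trR≡0 : tr R ≋ 0₂ [mod2^ suc N ]
    trR≡0 = tr-cross≋0 t₁ x₁ t₂ x₂ (tr-Θ≋0 g₁ t₁ x₁ 2t₁≈trg₁ x₁≈) (tr-Θ≋0 g₂ t₂ x₂ 2t₂≈trg₂ x₂≈)
      (*M-multiple x₁ x₂ x₁≡0 x₂≡0)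
    T≡t₁t₂ : T ≋ t₁ *₂ t₂ [mod2^ N ]
    T≡t₁t₂ = half-trace≋scalar (g₁ *M g₂) (t₁ *₂ t₂) R T
      (product-decomposition g₁ g₂ t₁ t₂ x₁ x₂ x₁≈ x₂≈) trR≡0 2T≈trg
    open ≋M-Reasoning N

  Θ-upperTriangular⇒upperTriangular : ∀ g t x → x ≈M (g -M (t ·M Id)) →
    UpperTriangular x → UpperTriangular g
  Θ-upperTriangular⇒upperTriangular g t x x≈g-tId x₂₁≈0 n = divides-diff (begin
    m21 g             ≈⟨ ≡₂₁ (Θ-decomposition g t x x≈g-tId) ⟩
    t *₂ 0₂ +₂ m21 x  ≈⟨ +-cong-mod (≡-mod-refl (seq t n * 0ℤ)) x₂₁≡0 ⟩
    t *₂ 0₂ +₂ 0₂     ≈⟨ ≡⇒≡-mod (vanish (seq t n)) ⟩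
    0₂                ∎)
    where
    open ≋-Reasoning n
    vanish : ∀ t → t * 0ℤ + 0ℤ ≡ 0ℤ
    vanish = solve-∀
    x₂₁≡0 : m21 x ≋ 0₂ [mod2^ n ]
    x₂₁≡0 = ∣-diff (x₂₁≈0 n)

  *M-upperTriangular : ∀ A B → UpperTriangular A → UpperTriangular B → UpperTriangular (A *M B)
  *M-upperTriangular A B a₂₁≈0 b₂₁≈0 n = divides-diff (begin
    m21 A *₂ m11 B +₂ m22 A *₂ m21 B  ≈⟨ +-cong-mod (*-cong-mod a₂₁≡0 (≡-mod-refl (seq (m11 B) n)))
                                                    (*-cong-mod (≡-mod-refl (seq (m22 A) n)) b₂₁≡0) ⟩
    0₂ *₂ m11 B +₂ m22 A *₂ 0₂        ≈⟨ ≡⇒≡-mod (vanish (seq (m11 B) n) (seq (m22 A) n)) ⟩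
    0₂                                ∎)
    where
    open ≋-Reasoning n
    vanish : ∀ b d → 0ℤ * b + d * 0ℤ ≡ 0ℤ
    vanish = solve-∀
    a₂₁≡0 : m21 A ≋ 0₂ [mod2^ n ]
    a₂₁≡0 = ∣-diff (a₂₁≈0 n)
    b₂₁≡0 : m21 B ≋ 0₂ [mod2^ n ]
    b₂₁≡0 = ∣-diff (b₂₁≈0 n)

  -M-scalar-upperTriangular : ∀ A t → UpperTriangular A → UpperTriangular (A -M (t ·M Id))
  -M-scalar-upperTriangular A t a₂₁≈0 n = divides-diff (begin
    m21 A -₂ t *₂ 0₂  ≈⟨ +-cong-mod a₂₁≡0 (≡-mod-refl (- (seq t n * 0ℤ))) ⟩
    0₂ -₂ t *₂ 0₂     ≈⟨ ≡⇒≡-mod (vanish (seq t n)) ⟩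
    0₂                ∎)
    where
    open ≋-Reasoning n
    vanish : ∀ t → 0ℤ - t * 0ℤ ≡ 0ℤ
    vanish = solve-∀
    a₂₁≡0 : m21 A ≋ 0₂ [mod2^ n ]
    a₂₁≡0 = ∣-diff (a₂₁≈0 n)

open import Data.Nat.Base using (_+_; _∸_)

lemma5p4 : (G : M₂ → Set) → ClosedSubgroupSL₂ G → TrivialMod4 G →
    (e₁ e₂ : ℕ) → 2 ≤ e₁ → 2 ≤ e₂ →
    (x₁ x₂ : M₂) → x₁ ∈Θ G → x₂ ∈Θ G →
    x₁ ≡M 0M [mod2^ e₁ ] → x₂ ≡M 0M [mod2^ e₂ ] →
    Σ M₂ (λ y → y ∈Θ G × (y ≡M (x₁ +M x₂) [mod2^ (e₁ + e₂ ∸ 1) ]))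
    × (UpperTriangular x₁ → UpperTriangular x₂ →
       Σ M₂ (λ y → y ∈Θ G × (y ≡M (x₁ +M x₂) [mod2^ (e₁ + e₂ ∸ 1) ]) × UpperTriangular y))
lemma5p4 G G-subgroup G-mod4 (suc (suc f₁)) (suc (suc f₂)) (s≤s (s≤s z≤n)) (s≤s (s≤s z≤n)) x₁ x₂
  (g₁ , g₁∈G , t₁ , 2t₁≈trg₁ , x₁≈g₁-t₁Id) (g₂ , g₂∈G , t₂ , 2t₂≈trg₂ , x₂≈g₂-t₂Id) x₁≡0 x₂≡0 =
  (y , y∈ΘG , y≡x₁+x₂) , λ x₁-UT x₂-UT → y , y∈ΘG , y≡x₁+x₂ , y-UT x₁-UT x₂-UT
  where
  open ClosedSubgroupSL₂ G-subgroup using (inSL₂; mul∈)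
  g∈G : G (g₁ *M g₂)
  g∈G = mul∈ g₁∈G g₂∈G
  half-trace : Σ ℤ₂ (λ T → T +₂ T ≈ tr (g₁ *M g₂))
  half-trace = even⇒half (tr (g₁ *M g₂)) (tr-even (g₁ *M g₂) (G-mod4 g∈G))
  T : ℤ₂
  T = proj₁ half-trace
  y : M₂
  y = (g₁ *M g₂) -M (T ·M Id)
  y∈ΘG : y ∈Θ G
  y∈ΘG = g₁ *M g₂ , g∈G , T , proj₂ half-trace , ≈M-refl y
  x₁≋0 : x₁ ≋M 0M [mod2^ suc (suc f₁) ]
  x₁≋0 = ≡M⇒≋M x₁ 0M x₁≡0
  x₂≋0 : x₂ ≋M 0M [mod2^ suc (suc f₂) ]
  x₂≋0 = ≡M⇒≋M x₂ 0M x₂≡0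
  y≡x₁+x₂ : y ≡M (x₁ +M x₂) [mod2^ (suc (suc f₁) + suc (suc f₂) ∸ 1) ]
  y≡x₁+x₂ = ≋M⇒≡M y (x₁ +M x₂) (Θ-product g₁ g₂ x₁ x₂ t₁ t₂ T x₁≈g₁-t₁Id x₂≈g₂-t₂Id
    2t₁≈trg₁ 2t₂≈trg₂ (proj₂ half-trace)
    (half-trace≋1 g₁ t₁ x₁ (inSL₂ g₁∈G) (G-mod4 g₁∈G) x₁≈g₁-t₁Id x₁≋0)
    (half-trace≋1 g₂ t₂ x₂ (inSL₂ g₂∈G) (G-mod4 g₂∈G) x₂≈g₂-t₂Id x₂≋0)
    x₁≋0 x₂≋0)
  y-UT : UpperTriangular x₁ → UpperTriangular x₂ → UpperTriangular y
  y-UT x₁-UT x₂-UT = -M-scalar-upperTriangular (g₁ *M g₂) T (*M-upperTriangular g₁ g₂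
    (Θ-upperTriangular⇒upperTriangular g₁ t₁ x₁ x₁≈g₁-t₁Id x₁-UT)
    (Θ-upperTriangular⇒upperTriangular g₂ t₂ x₂ x₂≈g₂-t₂Id x₂-UT))
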